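{- Let $\Lambda\subseteq\{\smile,\frown\}$ and let $\mathfrak{M}=\langle W,R,\{P_k\}_{k\in K}\rangle$ be a modally saturated Kripke model. Then for all $w,v\in W$: $w\rightsquigarrow_\Lambda v$ if and only if there is a directed $\Lambda$-simulation $(F,B)$ between $\mathfrak{M}$ and $\mathfrak{M}$ with $(w,v)\in F$.
   Context: Fix a set $K$. A Kripke model is $\mathfrak{M}=\langle W,R,\{P_k\}_{k\in K}\rangle$ with $W$ nonempty, $R\subseteq W\times W$, each $P_k\subseteq W$; $R[w]=\{v:wRv\}$. For $\Lambda\subseteq\{\smile,\frown\}$, $\mathcal{L}_\Lambda$ is generated by $\phi::=p_k\mid\top\mid\bot\mid\phi\wedge\phi\mid\phi\vee\phi\mid\star\phi$ ($k\in K$, $\star\in\Lambda$), with $w\Vdash p_k$ iff $w\in P_k$, classical $\top,\bot,\wedge,\vee$, $w\Vdash\smile\phi$ iff some $v$ with $wRv$ has $v\not\Vdash\phi$, and $w\Vdash\frown\phi$ iff every $v$ with $wRv$ has $v\not\Vdash\phi$. $w\rightsquigarrow_\Lambda v$ means: for every $\varphi\in\mathcal{L}_\Lambda$, $w\Vdash\varphi$ implies $v\Vdash\varphi$. $\mathcal{L}_{\sim,\Box,\Diamond}$ is generated by $\phi::=p_k\mid\top\mid\bot\mid\phi\wedge\phi\mid\phi\vee\phi\mid\sim\phi\mid\Box\phi\mid\Diamond\phi$ with $w\Vdash\sim\phi$ iff $w\not\Vdash\phi$, $w\Vdash\Box\phi$ iff all $v\in R[w]$ satisfy $\phi$, $w\Vdash\Diamond\phi$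 iff some $v\in R[w]$ satisfies $\phi$. $\mathfrak{M}$ is modally saturated if for every $w\in W$ and every $\Delta\subseteq\mathcal{L}_{\sim,\Box,\Diamond}$, if every finite subset of $\Delta$ is satisfied at some world of $R[w]$, then some world of $R[w]$ satisfies all of $\Delta$. A directed $\Lambda$-simulation between Kripke models $\mathfrak{M}_1=\langle W_1,R_1,\{P_{k,1}\}\rangle$ and $\mathfrak{M}_2=\langle W_2,R_2,\{P_{k,2}\}\rangle$ is a pair $(F,B)$ with $F\subseteq W_1\times W_2$, $B\subseteq W_2\times W_1$ such that for all $k\in K$: if $(w_1,w_2)\in F$ and $w_1\in P_{k,1}$ then $w_2\in P_{k,2}$; if $(w_2,w_1)\in B$ and $w_2\in P_{k,2}$ then $w_1\in P_{k,1}$; if $\smile\in\Lambda$: (F$\smile$) if $(w_1,w_2)\in F$ and $w_1R_1v_1$ then there is $t_2$ with $w_2R_2t_2$ and $(t_2,v_1)\in B$, and (B$\smile$) if $(w_2,w_1)\in B$ and $w_2R_2v_2$ then there is $t_1$ with $w_1R_1t_1$ and $(t_1,v_2)\in F$; if $\frown\in\Lambda$: (F$\frown$) if $(w_1,w_2)\in F$ and $w_2R_2v_2$ then there is $t_1$ with $w_1R_1t_1$ and $(v_2,t_1)\in B$, and (B$\frown$) if $(w_2,w_1)\in B$ and $w_1R_1v_1$ then there is $t_2$ with $w_2R_2t_2$ and $(v_1,t_2)\in F$. -}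

module Defs where

open import Data.Bool using (Bool; T)
open import Data.Empty using (⊥)
open import Data.Unit using (⊤)
open import Data.Product using (Σ; ∃; _×_; _,_)
open import Data.Sum using (_⊎_)
open import Data.List using (List)
open import Data.List.Relation.Unary.All using (All)
open import Relation.Nullary using (¬_)

record Model (K : Set) : Set₁ where
  field
    W  : Set
    w₀ : W                 -- W is nonempty
    R  : W → W → Set
    P  : K → W → Set

data Op : Set where
  smile frown : Op

-- Λ ⊆ {⌣,⌢} is given by its characteristic function.
Sig : Set
Sig = Op → Bool

data Form (K : Set) (Λ : Sig) : Set where
  var  : K → Form K Λ
  tt   : Form K Λ
  ff   : Form K Λ
  _∧_  : Form K Λ → Form K Λ → Form K Λ
  _∨_  : Form K Λ → Form K Λ → Form K Λ
  mod  : (o : Op) → T (Λ o) → Form K Λ → Form K Λ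

module _ {K : Set} (M : Model K) where
  open Model M

  infix 4 _⊩_
  _⊩_ : {Λ : Sig} → W → Form K Λ → Set
  w ⊩ var k        = P k w
  w ⊩ tt           = ⊤
  w ⊩ ff           = ⊥
  w ⊩ (φ ∧ ψ)      = (w ⊩ φ) × (w ⊩ ψ)
  w ⊩ (φ ∨ ψ)      = (w ⊩ φ) ⊎ (w ⊩ ψ)
  w ⊩ mod smile _ φ = Σ W λ v → R w v × ¬ (v ⊩ φ)
  w ⊩ mod frown _ φ = (v : W) → R w v → ¬ (v ⊩ φ)

  Leads : Sig → W → W → Set
  Leads Λ w v = (φ : Form K Λ) → w ⊩ φ → v ⊩ φ

data MForm (K : Set) : Set where
  var  : K → MForm K
  tt   : MForm K
  ff   : MForm K
  _∧_  : MForm K → MForm K → MForm K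
  _∨_  : MForm K → MForm K → MForm K
  ∼_   : MForm K → MForm K
  □_   : MForm K → MForm K
  ◇_   : MForm K → MForm K

module _ {K : Set} (M : Model K) where
  open Model M

  infix 4 _⊩ₘ_
  _⊩ₘ_ : W → MForm K → Set
  w ⊩ₘ var k   = P k w
  w ⊩ₘ tt      = ⊤
  w ⊩ₘ ff      = ⊥
  w ⊩ₘ (φ ∧ ψ) = (w ⊩ₘ φ) × (w ⊩ₘ ψ)
  w ⊩ₘ (φ ∨ ψ) = (w ⊩ₘ φ) ⊎ (w ⊩ₘ ψ)
  w ⊩ₘ (∼ φ)   = ¬ (w ⊩ₘ φ)
  w ⊩ₘ (□ φ)   = (v : W) → R w v → v ⊩ₘ φ
  w ⊩ₘ (◇ φ)   = Σ W λ v → R w v × (v ⊩ₘ φ)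

  -- Modal saturation: Δ ranges over all subsets of L_{∼,□,◇};
  -- finite subsets of Δ are lists of members of Δ.
  ModallySaturated : Set₁
  ModallySaturated =
    (w : W) (Δ : MForm K → Set) →
    ((Γ : List (MForm K)) → All Δ Γ →
       Σ W λ v → R w v × All (λ φ → v ⊩ₘ φ) Γ) →
    Σ W λ v → R w v × ((φ : MForm K) → Δ φ → v ⊩ₘ φ)

module _ {K : Set} (Λ : Sig) (M₁ M₂ : Model K) where
  private
    module M₁ = Model M₁
    module M₂ = Model M₂

  record DirSim (F : M₁.W → M₂.W → Set) (B : M₂.W → M₁.W → Set) : Set where
    field
      atomF : ∀ k {w₁ w₂} → F w₁ w₂ → M₁.P k w₁ → M₂.P k w₂
      atomB : ∀ k {w₂ w₁} → B w₂ w₁ → M₂.P k w₂ → M₁.P k w₁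
      F⌣ : T (Λ smile) → ∀ {w₁ w₂ v₁} → F w₁ w₂ → M₁.R w₁ v₁ →
             Σ M₂.W λ t₂ → M₂.R w₂ t₂ × B t₂ v₁
      B⌣ : T (Λ smile) → ∀ {w₂ w₁ v₂} → B w₂ w₁ → M₂.R w₂ v₂ →
             Σ M₁.W λ t₁ → M₁.R w₁ t₁ × F t₁ v₂
      F⌢ : T (Λ frown) → ∀ {w₁ w₂ v₂} → F w₁ w₂ → M₂.R w₂ v₂ →
             Σ M₁.W λ t₁ → M₁.R w₁ t₁ × B v₂ t₁
      B⌢ : T (Λ frown) → ∀ {w₂ w₁ v₁} → B w₂ w₁ → M₁.R w₁ v₁ →
             Σ M₂.W λ t₂ → M₂.R w₂ t₂ × F v₁ t₂

{-# OPTIONS --safe #-}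
module Submission where

open import Defs
open import Data.Product using (Σ; _×_; _,_)
open import Function.Bundles using (_⇔_; mk⇔)
open import Axiom.ExcludedMiddle using (ExcludedMiddle)
open import Axiom.DoubleNegationElimination using (DoubleNegationElimination; em⇒dne)
open import Level using (0ℓ)
open import Data.Bool using (T)
open import Data.Sum using (inj₁; inj₂)
open import Data.List using (List; []; _∷_)
open import Data.List.Relation.Unary.All using (All; []; _∷_)
open import Relation.Nullary using (¬_)
open import Relation.Binary.PropositionalEquality using (_≡_; refl)

-- Soundness is an induction on formulas: F carries truth forwards, and the
-- negative modalities swap F and B exactly as the simulation clauses do.
-- Completeness: Λ-entailment itself (read in both directions) is a directed
-- simulation.  Λ-formulas translate into L_{∼,□,◇} (⌣φ as ◇∼φ, ⌢φ as □∼φ).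
-- For ⌣, if a ⇝ b and a R x, the set {∼φ | x ⊮ φ} is finitely satisfiable
-- in R[b], since a finite part is implied by ∼ of a single disjunction ψ
-- and a ⊩ ⌣ψ; a saturating witness t then cannot satisfy any φ false at x,
-- so classically t ⇝ x.  For ⌢, dually, if b R y then {φ | y ⊩ φ} is
-- finitely satisfiable in R[a], for otherwise a ⊩ ⌢ψ for a conjunction ψ
-- true at y, whence b ⊩ ⌢ψ.  Nothing here needs the two models to coincide.

LeadsBetween : {K : Set} → Sig → (M₁ M₂ : Model K) → Model.W M₁ → Model.W M₂ → Set
LeadsBetween {K} Λ M₁ M₂ w₁ w₂ = (φ : Form K Λ) → _⊩_ M₁ w₁ φ → _⊩_ M₂ w₂ φ

module _ {K : Set} {Λ : Sig} {M₁ M₂ : Model K}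
         {F : Model.W M₁ → Model.W M₂ → Set} {B : Model.W M₂ → Model.W M₁ → Set}
         (S : DirSim Λ M₁ M₂ F B) where
  open DirSim S

  F⊆LeadsBetween : ∀ {w₁ w₂} → F w₁ w₂ → LeadsBetween Λ M₁ M₂ w₁ w₂
  B⊆LeadsBetween : ∀ {w₂ w₁} → B w₂ w₁ → LeadsBetween Λ M₂ M₁ w₂ w₁

  F⊆LeadsBetween Fw (var k) w⊩k = atomF k Fw w⊩k
  F⊆LeadsBetween Fw tt _ = _
  F⊆LeadsBetween Fw ff ()
  F⊆LeadsBetween Fw (φ ∧ ψ) (wφ , wψ) = F⊆LeadsBetween Fw φ wφ , F⊆LeadsBetween Fw ψ wψ
  F⊆LeadsBetween Fw (φ ∨ ψ) (inj₁ wφ) = inj₁ (F⊆LeadsBetween Fw φ wφ)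
  F⊆LeadsBetween Fw (φ ∨ ψ) (inj₂ wψ) = inj₂ (F⊆LeadsBetween Fw ψ wψ)
  F⊆LeadsBetween Fw (mod smile s φ) (v , wv , v⊮φ) =
    let t , wt , Btv = F⌣ s Fw wv in t , wt , λ tφ → v⊮φ (B⊆LeadsBetween Btv φ tφ)
  F⊆LeadsBetween Fw (mod frown f φ) w⌢φ v wv vφ =
    let t , wt , Bvt = F⌢ f Fw wv in w⌢φ t wt (B⊆LeadsBetween Bvt φ vφ)

  B⊆LeadsBetween Bw (var k) w⊩k = atomB k Bw w⊩k
  B⊆LeadsBetween Bw tt _ = _
  B⊆LeadsBetween Bw ff ()
  B⊆LeadsBetween Bw (φ ∧ ψ) (wφ , wψ) = B⊆LeadsBetween Bw φ wφ , B⊆LeadsBetween Bw ψ wψ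
  B⊆LeadsBetween Bw (φ ∨ ψ) (inj₁ wφ) = inj₁ (B⊆LeadsBetween Bw φ wφ)
  B⊆LeadsBetween Bw (φ ∨ ψ) (inj₂ wψ) = inj₂ (B⊆LeadsBetween Bw ψ wψ)
  B⊆LeadsBetween Bw (mod smile s φ) (v , wv , v⊮φ) =
    let t , wt , Ftv = B⌣ s Bw wv in t , wt , λ tφ → v⊮φ (F⊆LeadsBetween Ftv φ tφ)
  B⊆LeadsBetween Bw (mod frown f φ) w⌢φ v wv vφ =
    let t , wt , Fvt = B⌢ f Bw wv in w⌢φ t wt (F⊆LeadsBetween Fvt φ vφ)

translate : {K : Set} {Λ : Sig} → Form K Λ → MForm K
translate (var k) = var k
translate tt = tt
translate ff = ff
translate (φ ∧ ψ) = translate φ ∧ translate ψ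
translate (φ ∨ ψ) = translate φ ∨ translate ψ
translate (mod smile _ φ) = ◇ (∼ translate φ)
translate (mod frown _ φ) = □ (∼ translate φ)

module _ {K : Set} {Λ : Sig} (M : Model K) where

  ⊩⇒⊩ₘ-translate : ∀ {w} (φ : Form K Λ) → _⊩_ M w φ → _⊩ₘ_ M w (translate φ)
  ⊩ₘ-translate⇒⊩ : ∀ {w} (φ : Form K Λ) → _⊩ₘ_ M w (translate φ) → _⊩_ M w φ

  ⊩⇒⊩ₘ-translate (var k) w⊩k = w⊩k
  ⊩⇒⊩ₘ-translate tt _ = _
  ⊩⇒⊩ₘ-translate ff ()
  ⊩⇒⊩ₘ-translate (φ ∧ ψ) (wφ , wψ) = ⊩⇒⊩ₘ-translate φ wφ , ⊩⇒⊩ₘ-translate ψ wψ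
  ⊩⇒⊩ₘ-translate (φ ∨ ψ) (inj₁ wφ) = inj₁ (⊩⇒⊩ₘ-translate φ wφ)
  ⊩⇒⊩ₘ-translate (φ ∨ ψ) (inj₂ wψ) = inj₂ (⊩⇒⊩ₘ-translate ψ wψ)
  ⊩⇒⊩ₘ-translate (mod smile _ φ) (v , wv , v⊮φ) = v , wv , λ vφ → v⊮φ (⊩ₘ-translate⇒⊩ φ vφ)
  ⊩⇒⊩ₘ-translate (mod frown _ φ) w⌢φ v wv vφ = w⌢φ v wv (⊩ₘ-translate⇒⊩ φ vφ)

  ⊩ₘ-translate⇒⊩ (var k) w⊩k = w⊩k
  ⊩ₘ-translate⇒⊩ tt _ = _
  ⊩ₘ-translate⇒⊩ ff ()
  ⊩ₘ-translate⇒⊩ (φ ∧ ψ) (wφ , wψ) = ⊩ₘ-translate⇒⊩ φ wφ , ⊩ₘ-translate⇒⊩ ψ wψ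
  ⊩ₘ-translate⇒⊩ (φ ∨ ψ) (inj₁ wφ) = inj₁ (⊩ₘ-translate⇒⊩ φ wφ)
  ⊩ₘ-translate⇒⊩ (φ ∨ ψ) (inj₂ wψ) = inj₂ (⊩ₘ-translate⇒⊩ ψ wψ)
  ⊩ₘ-translate⇒⊩ (mod smile _ φ) (v , wv , v⊮φ) = v , wv , λ vφ → v⊮φ (⊩⇒⊩ₘ-translate φ vφ)
  ⊩ₘ-translate⇒⊩ (mod frown _ φ) w⌢φ v wv vφ = w⌢φ v wv (⊩⇒⊩ₘ-translate φ vφ)

module _ {K : Set} {Λ : Sig} where

  TranslatedTheory : (M : Model K) → Model.W M → MForm K → Set
  TranslatedTheory M y χ = Σ (Form K Λ) λ φ → χ ≡ translate φ × _⊩_ M y φ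

  NegatedTranslatedCotheory : (M : Model K) → Model.W M → MForm K → Set
  NegatedTranslatedCotheory M x χ = Σ (Form K Λ) λ φ → χ ≡ ∼ translate φ × ¬ _⊩_ M x φ

  TranslatedTheory-finite⇒conjunction :
    (M N : Model K) {y : Model.W N} (Γ : List (MForm K)) →
    All (TranslatedTheory N y) Γ →
    Σ (Form K Λ) λ ψ → _⊩_ N y ψ × (∀ {t} → _⊩_ M t ψ → All (_⊩ₘ_ M t) Γ)
  TranslatedTheory-finite⇒conjunction M N [] [] = tt , _ , λ _ → []
  TranslatedTheory-finite⇒conjunction M N (_ ∷ Γ) ((φ , refl , yφ) ∷ Γ-true) =
    let ψ , yψ , ψ⇒Γ = TranslatedTheory-finite⇒conjunction M N Γ Γ-true
    in φ ∧ ψ , (yφ , yψ) , λ (tφ , tψ) → ⊩⇒⊩ₘ-translate M φ tφ ∷ ψ⇒Γ tψ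

  NegatedTranslatedCotheory-finite⇒disjunction :
    (M N : Model K) {x : Model.W N} (Γ : List (MForm K)) →
    All (NegatedTranslatedCotheory N x) Γ →
    Σ (Form K Λ) λ ψ → ¬ _⊩_ N x ψ × (∀ {t} → ¬ _⊩_ M t ψ → All (_⊩ₘ_ M t) Γ)
  NegatedTranslatedCotheory-finite⇒disjunction M N [] [] = ff , (λ ()) , λ _ → []
  NegatedTranslatedCotheory-finite⇒disjunction M N (_ ∷ Γ) ((φ , refl , x⊮φ) ∷ Γ-true) =
    let ψ , x⊮ψ , ¬ψ⇒Γ = NegatedTranslatedCotheory-finite⇒disjunction M N Γ Γ-true
    in φ ∨ ψ
     , (λ { (inj₁ xφ) → x⊮φ xφ ; (inj₂ xψ) → x⊮ψ xψ })
     , λ t⊮φ∨ψ → (λ tφ → t⊮φ∨ψ (inj₁ (⊩ₘ-translate⇒⊩ M φ tφ)))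
                 ∷ ¬ψ⇒Γ (λ tψ → t⊮φ∨ψ (inj₂ tψ))

module _ {K : Set} {Λ : Sig} (dne : DoubleNegationElimination 0ℓ) where

  LeadsBetween-smile-step :
    (M₁ M₂ : Model K) → ModallySaturated M₂ → T (Λ smile) →
    ∀ {a b x} → LeadsBetween Λ M₁ M₂ a b → Model.R M₁ a x →
    Σ (Model.W M₂) λ t → Model.R M₂ b t × LeadsBetween Λ M₂ M₁ t x
  LeadsBetween-smile-step M₁ M₂ sat s {b = b} {x} a⇝b ax =
    let t , bt , t⊩Δ = sat b (NegatedTranslatedCotheory M₁ x) finitely-satisfiable
    in t , bt , λ φ tφ → dne λ x⊮φ →
         t⊩Δ (∼ translate φ) (φ , refl , x⊮φ) (⊩⇒⊩ₘ-translate M₂ φ tφ)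
    where
    finitely-satisfiable : (Γ : List (MForm K)) → All (NegatedTranslatedCotheory M₁ x) Γ →
                           Σ (Model.W M₂) λ t → Model.R M₂ b t × All (_⊩ₘ_ M₂ t) Γ
    finitely-satisfiable Γ Γ⊆Δ =
      let ψ , x⊮ψ , ¬ψ⇒Γ = NegatedTranslatedCotheory-finite⇒disjunction M₂ M₁ Γ Γ⊆Δ
          t , bt , t⊮ψ = a⇝b (mod smile s ψ) (x , ax , x⊮ψ)
      in t , bt , ¬ψ⇒Γ t⊮ψ

  LeadsBetween-frown-step :
    (M₁ M₂ : Model K) → ModallySaturated M₁ → T (Λ frown) →
    ∀ {a b y} → LeadsBetween Λ M₁ M₂ a b → Model.R M₂ b y →
    Σ (Model.W M₁) λ t → Model.R M₁ a t × LeadsBetween Λ M₂ M₁ y t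
  LeadsBetween-frown-step M₁ M₂ sat f {a} {y = y} a⇝b by =
    let t , at , t⊩Δ = sat a (TranslatedTheory M₂ y) finitely-satisfiable
    in t , at , λ φ yφ → ⊩ₘ-translate⇒⊩ M₁ φ (t⊩Δ (translate φ) (φ , refl , yφ))
    where
    finitely-satisfiable : (Γ : List (MForm K)) → All (TranslatedTheory M₂ y) Γ →
                           Σ (Model.W M₁) λ t → Model.R M₁ a t × All (_⊩ₘ_ M₁ t) Γ
    finitely-satisfiable Γ Γ⊆Δ =
      let ψ , yψ , ψ⇒Γ = TranslatedTheory-finite⇒conjunction M₁ M₂ Γ Γ⊆Δ
          t , at , tψ = dne λ no-ψ-successor →
            a⇝b (mod frown f ψ) (λ t at tψ → no-ψ-successor (t , at , tψ)) y by yψ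
      in t , at , ψ⇒Γ tψ

  LeadsBetween-DirSim : (M₁ M₂ : Model K) → ModallySaturated M₁ → ModallySaturated M₂ →
                        DirSim Λ M₁ M₂ (LeadsBetween Λ M₁ M₂) (LeadsBetween Λ M₂ M₁)
  LeadsBetween-DirSim M₁ M₂ sat₁ sat₂ = record
    { atomF = λ k w⇝v → w⇝v (var k)
    ; atomB = λ k w⇝v → w⇝v (var k)
    ; F⌣ = λ s → LeadsBetween-smile-step M₁ M₂ sat₂ s
    ; B⌣ = λ s → LeadsBetween-smile-step M₂ M₁ sat₁ s
    ; F⌢ = λ f → LeadsBetween-frown-step M₁ M₂ sat₁ f
    ; B⌢ = λ f → LeadsBetween-frown-step M₂ M₁ sat₂ f
    }

corollary6p9 : ExcludedMiddle 0ℓ →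
    {K : Set} (Λ : Sig) (M : Model K) → ModallySaturated M →
    (w v : Model.W M) →
    Leads M Λ w v ⇔
      Σ (Model.W M → Model.W M → Set) λ F →
      Σ (Model.W M → Model.W M → Set) λ B →
      DirSim Λ M M F B × F w v
corollary6p9 em Λ M sat w v = mk⇔
  (λ w⇝v → LeadsBetween Λ M M , LeadsBetween Λ M M
          , LeadsBetween-DirSim (em⇒dne em) M M sat sat , w⇝v)
  (λ (F , B , S , Fwv) → F⊆LeadsBetween S Fwv)
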